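{- Let $Q$, $\mathcal{O}$, $L$ be as in the context. If $\gamma,\gamma_1,\gamma_1'$ are saturated chains from $u$ to $v$ in an interval $[u,v]_L$ whose lowest edges (cover relations out of $u$) are pairwise distinct, then the paths $\gamma*\gamma_1$ and $\gamma*\gamma_1'$ in the move graph share only the node $\gamma$, i.e. $(\gamma*\gamma_1)\cap(\gamma*\gamma_1')=\{\gamma\}$.
   Context: $Q$ is a polytope, $\mathcal{O}$ a facial orientation of its 1-skeleton (acyclic, each face $F$ has a unique source $\mathrm{srce}(F)$ and sink $\mathrm{sink}(F)$), $Q$ is $\mathcal{O}$-directionally simple (for each vertex $x$ and each subset $E$ of edges directed out of $x$ there is a distinct $|E|$-face containing $x$ and $E$), and $\mathcal{O}$ is the Hasse diagram of a lattice $L$ on the vertices of $Q$. A move across a 2-face $F$ replaces a segment of a chain running along one directed boundary path of $F$ from $\mathrm{srce}(F)$ to $\mathrm{sink}(F)$ by the other boundary path. For saturated chains $\gamma_1,\gamma_2$ from $u$ to $v$, the path of moves $\gamma_1*\gamma_2$ is defined recursively: if $\gamma_1=\gamma_2$ it is trivial. Otherwise let $x$ be the lowest element of $\gamma_1\cap\gamma_2$ covered by distinct elements $a_1\in\gamma_1$, $a_2\in\gamma_2$, and $x'$ the next element of $\gamma_1\cap\gamma_2$ above $x$. Let $F$ be the unique 2-face containing edges $xa_1,xa_2$ (then $\mathrm{sink}(F)=a_1\vee a_2\le x'$). Choose a saturated chain $p$ from $\mathrm{sink}(F)$ to $v$ through $x'$, agreeing with $\gamma_1$ on $[x',v]$,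 and agreeing with $\gamma_1$ on $[\mathrm{sink}(F),v]$ if $\mathrm{sink}(F)\in\gamma_1$. Let $\gamma_i^F$ follow $\gamma_i$ from $u$ to $a_i$, then the boundary path of $F$ from $a_i$ to $\mathrm{sink}(F)$, then $p$. Then $\gamma_1*\gamma_2$ is: the moves of $\gamma_1*\gamma_1^F$, then the move across $F$ to $\gamma_2^F$, then the moves of $\gamma_2^F*\gamma_2$; its nodes are the chains visited (for any choices made). -}

module Defs where

open import Level using (0ℓ)
open import Data.Nat as ℕ using (ℕ)
open import Data.Fin as F using (Fin)
open import Data.Fin.Subset as Sub using (Subset; ⁅_⁆; _∪_; ∣_∣)
open import Data.List using (List; []; _∷_; _++_)
open import Data.List.Relation.Unary.All using (All)
import Data.List.Membership.Propositional as LM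
open import Data.Product using (Σ; ∃; ∃₂; _×_; _,_)
open import Data.Sum using (_⊎_)
open import Relation.Nullary using (¬_)
open import Relation.Binary.PropositionalEquality using (_≡_; _≢_)
open import Relation.Binary.Structures using (IsTotalOrder)
open import Relation.Binary.Construct.Closure.Transitive using (TransClosure)
open import Relation.Binary.Construct.Closure.ReflexiveTransitive using (Star)
open import Algebra.Bundles using (CommutativeRing)

record OrderedField : Set₁ where
  field
    commutativeRing : CommutativeRing 0ℓ 0ℓ
  open CommutativeRing commutativeRing public
  field
    _≤_          : Carrier → Carrier → Set
    isTotalOrder : IsTotalOrder _≈_ _≤_
    0≉1          : ¬ (0# ≈ 1#)
    inverse      : ∀ x → ¬ (x ≈ 0#) → ∃ λ y → (x * y) ≈ 1#
    +-mono-≤     : ∀ {x y} z → x ≤ y → (x + z) ≤ (y + z)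
    *-nonneg     : ∀ {x y} → 0# ≤ x → 0# ≤ y → 0# ≤ (x * y)

-- Everything below is relative to: an ordered field K, a dimension n,
-- a polytope Q = conv {V i | i : Fin m} ⊆ K^n given by its vertex list V,
-- and a relation _⟶_ on the vertex indices (the orientation 𝒪).

module Polytope (K : OrderedField) {n m : ℕ} (V : Fin m → Fin n → OrderedField.Carrier K)
                (_⟶_ : Fin m → Fin m → Set) where

  open OrderedField K renaming (_≤_ to _≤K_)

  Vertex : Set
  Vertex = Fin m

  sumK : ∀ {k} → (Fin k → Carrier) → Carrier
  sumK {ℕ.zero}  f = 0#
  sumK {ℕ.suc k} f = f F.zero + sumK (λ i → f (F.suc i))

  dot : (Fin n → Carrier) → (Fin n → Carrier) → Carrier
  dot c x = sumK (λ j → c j * x j)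

  AffIndep : ∀ {k} → (Fin (ℕ.suc k) → Vertex) → Set
  AffIndep {k} f =
    ∀ (λ' : Fin (ℕ.suc k) → Carrier) →
      sumK λ' ≈ 0# →
      (∀ j → sumK (λ i → λ' i * V (f i) j) ≈ 0#) →
      ∀ i → λ' i ≈ 0#

  -- the convex hull of {V i | i ∈ S} has (affine) dimension d
  HasDim : Subset m → ℕ → Set
  HasDim S d =
    (∃ λ (f : Fin (ℕ.suc d) → Vertex) → (∀ i → f i Sub.∈ S) × AffIndep f) ×
    (∀ (f : Fin (ℕ.suc (ℕ.suc d)) → Vertex) → (∀ i → f i Sub.∈ S) → ¬ AffIndep f)

  -- S is the vertex set of a (nonempty) face of Q: the set of V i
  -- maximising some linear functional c
  IsFace : Subset m → Set
  IsFace S = ∃ λ (c : Fin n → Carrier) → ∀ i →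
    (i Sub.∈ S → ∀ j → dot c (V j) ≤K dot c (V i)) ×
    ((∀ j → dot c (V j) ≤K dot c (V i)) → i Sub.∈ S)

  -- V lists exactly the vertices of Q (each V i is a vertex, no repetitions)
  IsVertexList : Set
  IsVertexList = ∀ i → IsFace ⁅ i ⁆

  Edge : Vertex → Vertex → Set
  Edge i j = IsFace (⁅ i ⁆ ∪ ⁅ j ⁆) × HasDim (⁅ i ⁆ ∪ ⁅ j ⁆) 1

  IsOrientation : Set
  IsOrientation =
    (∀ i j → i ⟶ j → Edge i j) ×
    (∀ i j → Edge i j → i ⟶ j ⊎ j ⟶ i) ×
    (∀ i j → i ⟶ j → ¬ (j ⟶ i))

  Acyclic : Set
  Acyclic = ∀ i → ¬ TransClosure _⟶_ i i

  IsSource IsSink : Subset m → Vertex → Set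
  IsSource F x = x Sub.∈ F × (∀ y → y Sub.∈ F → ¬ (y ⟶ x))
  IsSink   F x = x Sub.∈ F × (∀ y → y Sub.∈ F → ¬ (x ⟶ y))

  Facial : Set
  Facial = ∀ F → IsFace F →
    (∃ λ s → IsSource F s × ∀ s' → IsSource F s' → s' ≡ s) ×
    (∃ λ t → IsSink F t × ∀ t' → IsSink F t' → t' ≡ t)

  IsFacialOrientation : Set
  IsFacialOrientation = IsOrientation × Acyclic × Facial

  DirectionallySimple : Set
  DirectionallySimple = ∀ x (E : Subset m) → (∀ y → y Sub.∈ E → x ⟶ y) →
    ∃ λ F → (IsFace F × HasDim F ∣ E ∣ × x Sub.∈ F × E Sub.⊆ F) ×
            (∀ F' → IsFace F' × HasDim F' ∣ E ∣ × x Sub.∈ F' × E Sub.⊆ F' → F' ≡ F)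

  _≤L_ : Vertex → Vertex → Set
  x ≤L y = Star _⟶_ x y

  _<L_ : Vertex → Vertex → Set
  x <L y = x ≤L y × x ≢ y

  IsHasseOfLattice : Set
  IsHasseOfLattice =
    (∀ x y → x ⟶ y → ∀ z → x ≤L z → z ≤L y → z ≡ x ⊎ z ≡ y) ×
    (∀ x y → ∃ λ j → x ≤L j × y ≤L j × ∀ w → x ≤L w → y ≤L w → j ≤L w) ×
    (∀ x y → ∃ λ k → k ≤L x × k ≤L y × ∀ w → w ≤L x → w ≤L y → w ≤L k)

  data Chain : Vertex → Vertex → List Vertex → Set where
    single : ∀ x → Chain x x (x ∷ [])
    cover  : ∀ {x y v ys} → x ⟶ y → Chain y v ys → Chain x v (x ∷ ys)

  _∈L_ : Vertex → List Vertex → Set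
  _∈L_ = LM._∈_

  Succ : List Vertex → Vertex → Vertex → Set
  Succ γ x a = ∃₂ λ α β → γ ≡ α ++ (x ∷ a ∷ β)

  AgreeFrom : Vertex → List Vertex → List Vertex → Set
  AgreeFrom z p γ = ∃ λ α → ∃ λ β → ∃ λ r → p ≡ α ++ (z ∷ r) × γ ≡ β ++ (z ∷ r)

  -- Star* v γ₁ γ₂ ns : (γ₁, γ₂ chains ending at v) ns is the list of nodes (chains visited, in order)
  -- of the path of moves γ₁ * γ₂, for some admissible choices.

  data Star* (v : Vertex) : List Vertex → List Vertex → List (List Vertex) → Set where
    trivial : ∀ γ → Star* v γ γ (γ ∷ [])
    step : ∀ {γ₁ γ₂ x a₁ a₂ x' F t p p' pre₁ pre₂ r₁ r₂ b₁ b₂ γ₁F γ₂F ns₁ ns₂} →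
      γ₁ ≢ γ₂ →
      -- x: lowest element of γ₁ ∩ γ₂ covered by distinct a₁ ∈ γ₁, a₂ ∈ γ₂
      x ∈L γ₁ → x ∈L γ₂ → Succ γ₁ x a₁ → Succ γ₂ x a₂ → a₁ ≢ a₂ →
      (∀ y c₁ c₂ → y ∈L γ₁ → y ∈L γ₂ → Succ γ₁ y c₁ → Succ γ₂ y c₂ → c₁ ≢ c₂ → x ≤L y) →
      -- x': next element of γ₁ ∩ γ₂ above x
      x' ∈L γ₁ → x' ∈L γ₂ → x <L x' →
      (∀ z → z ∈L γ₁ → z ∈L γ₂ → x <L z → x' ≤L z) →
      -- F: the 2-face containing the edges x a₁, x a₂; t = sink(F)
      IsFace F → HasDim F 2 → x Sub.∈ F → a₁ Sub.∈ F → a₂ Sub.∈ F →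
      IsSink F t →
      -- p: saturated chain from t to v through x', agreeing with γ₁ on [x',v],
      -- and on [t,v] if t ∈ γ₁
      Chain t v p →
      p ≡ t ∷ p' →
      AgreeFrom x' p γ₁ →
      (t ∈L γ₁ → AgreeFrom t p γ₁) →
      -- γᵢF: γᵢ up to aᵢ, boundary path of F from aᵢ to t, then p
      γ₁ ≡ pre₁ ++ (a₁ ∷ r₁) → γ₂ ≡ pre₂ ++ (a₂ ∷ r₂) →
      Chain a₁ t b₁ → All (Sub._∈ F) b₁ →
      Chain a₂ t b₂ → All (Sub._∈ F) b₂ →
      γ₁F ≡ pre₁ ++ b₁ ++ p' → γ₂F ≡ pre₂ ++ b₂ ++ p' →
      -- the moves of γ₁ * γ₁F, the move across F, the moves of γ₂F * γ₂
      Star* v γ₁ γ₁F ns₁ → Star* v γ₂F γ₂ ns₂ →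
      Star* v γ₁ γ₂ (ns₁ ++ ns₂)

-- A chain c ≠ γ on the path γ * δ leaves γ at a branching (W , y , s): it follows γ through W and y
-- and then takes an edge y ⟶ s off γ. Unfolding the recursive construction, the branching of every
-- such node is reached from the branching of δ by moves: at a branching (W , y , s) where γ continues
-- with y ⟶ g, the move crosses the 2-face F containing y ⟶ g and y ⟶ s, and the moved chain branches
-- off γ further up, at a vertex y₂ of F such that the edge of γ into y₂ and the new edge out of y₂ lie
-- on F. Such a step can be undone: two consecutive edges determine the 2-face, y is its source, and y
-- has only two neighbours on F. Both γ₁ and γ₁′ branch off γ at u, with W empty, so a common node
-- other than γ would trace back to both branchings and force a₁ = a₁′.
-- The geometric facts are linear algebra over the ordered field: a third neighbour of y, or a vertex
-- of a 2-face outside the face through the two edges, would give four affinely independent points.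

{-# OPTIONS --safe #-}
module Submission where

open import Defs
open import Data.Nat as ℕ using (ℕ; zero; suc)
open import Data.Fin as F using (Fin)
open import Data.Fin.Subset as Sub using (Subset; ⁅_⁆; _∪_)
open import Data.Product using (∃; ∃₂; _×_; _,_; proj₁; proj₂)
open import Data.Sum using (_⊎_; inj₁; inj₂; [_,_]′)
open import Data.Empty using (⊥; ⊥-elim)
open import Relation.Nullary using (¬_; yes; no)
open import Relation.Binary.PropositionalEquality as ≡ using (_≡_; _≢_; refl; cong)
open import Relation.Binary.Structures using (IsTotalOrder)
open import Relation.Binary.Rewriting using (Deterministic)
open import Algebra.Bundles using (CommutativeMonoid)

module OrderedFieldProperties (K : OrderedField) where
  open OrderedField K hiding (_≤_)

  -- Defs declares _≤_ without fixity; this copy binds more loosely than _+_ and _*_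
  infix 4 _≤_
  _≤_ : Carrier → Carrier → Set
  _≤_ = OrderedField._≤_ K

  open IsTotalOrder isTotalOrder using (total; antisym; ≤-respˡ-≈; ≤-respʳ-≈)
  open import Algebra.Properties.Ring ring using (-‿distribˡ-*; -‿distribʳ-*)
  open import Algebra.Properties.AbelianGroup +-abelianGroup
    using (⁻¹-involutive; ε⁻¹≈ε; inverseˡ-unique; ⁻¹-∙-comm)
  open import Relation.Binary.Reasoning.Setoid setoid

  Negative : Carrier → Set
  Negative x = x ≤ 0# × ¬ (x ≈ 0#)

  x*y≈0⇒x≈0 : ∀ {x y} → x * y ≈ 0# → ¬ (y ≈ 0#) → x ≈ 0#
  x*y≈0⇒x≈0 {x} {y} xy≈0 y≉0 with inverse y y≉0
  ... | y⁻¹ , yy⁻¹≈1 = begin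
    x              ≈⟨ *-identityʳ x ⟨
    x * 1#         ≈⟨ *-congˡ yy⁻¹≈1 ⟨
    x * (y * y⁻¹)  ≈⟨ *-assoc x y y⁻¹ ⟨
    (x * y) * y⁻¹  ≈⟨ *-congʳ xy≈0 ⟩
    0# * y⁻¹       ≈⟨ zeroˡ y⁻¹ ⟩
    0#             ∎

  x≤0⇒0≤-x : ∀ {x} → x ≤ 0# → 0# ≤ - x
  x≤0⇒0≤-x {x} x≤0 = ≤-respʳ-≈ (+-identityˡ (- x)) (≤-respˡ-≈ (-‿inverseʳ x) (+-mono-≤ (- x) x≤0))

  0≤x⇒-x≤0 : ∀ {x} → 0# ≤ x → - x ≤ 0#
  0≤x⇒-x≤0 {x} 0≤x = ≤-respʳ-≈ (-‿inverseʳ x) (≤-respˡ-≈ (+-identityˡ (- x)) (+-mono-≤ (- x) 0≤x))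

  -x≈0⇒x≈0 : ∀ {x} → - x ≈ 0# → x ≈ 0#
  -x≈0⇒x≈0 {x} -x≈0 = trans (sym (⁻¹-involutive x)) (trans (-‿cong -x≈0) ε⁻¹≈ε)

  0≤x⇒x*y≤0 : ∀ {x y} → 0# ≤ x → y ≤ 0# → x * y ≤ 0#
  0≤x⇒x*y≤0 {x} {y} 0≤x y≤0 =
    ≤-respˡ-≈ (⁻¹-involutive (x * y))
      (0≤x⇒-x≤0 (≤-respʳ-≈ (sym (-‿distribʳ-* x y)) (*-nonneg 0≤x (x≤0⇒0≤-x y≤0))))

  x+y≈0⇒x≈0 : ∀ {x y} → x ≤ 0# → y ≤ 0# → x + y ≈ 0# → x ≈ 0#
  x+y≈0⇒x≈0 {x} {y} x≤0 y≤0 x+y≈0 =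
    antisym x≤0 (≤-respʳ-≈ (sym (inverseˡ-unique x y x+y≈0)) (x≤0⇒0≤-x y≤0))

  SameSign : Carrier → Carrier → Set
  SameSign a b = (0# ≤ a × 0# ≤ b) ⊎ (a ≤ 0# × b ≤ 0#)

  sameSign-pigeonhole : ∀ a b c → SameSign a b ⊎ SameSign a c ⊎ SameSign b c
  sameSign-pigeonhole a b c with total 0# a | total 0# b | total 0# c
  ... | inj₁ 0≤a | inj₁ 0≤b | _        = inj₁ (inj₁ (0≤a , 0≤b))
  ... | inj₂ a≤0 | inj₂ b≤0 | _        = inj₁ (inj₂ (a≤0 , b≤0))
  ... | inj₁ 0≤a | inj₂ _   | inj₁ 0≤c = inj₂ (inj₁ (inj₁ (0≤a , 0≤c)))
  ... | inj₂ a≤0 | inj₁ _   | inj₂ c≤0 = inj₂ (inj₁ (inj₂ (a≤0 , c≤0)))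
  ... | inj₁ _   | inj₂ b≤0 | inj₂ c≤0 = inj₂ (inj₂ (inj₂ (b≤0 , c≤0)))
  ... | inj₂ _   | inj₁ 0≤b | inj₁ 0≤c = inj₂ (inj₂ (inj₁ (0≤b , 0≤c)))

  Balanced : Carrier → Carrier → Set
  Balanced a b = ∃₂ λ X Y → Negative X × Negative Y × a * X + b * Y ≈ 0#

  balanced-sym : ∀ {a b} → Balanced a b → Balanced b a
  balanced-sym {a} {b} (X , Y , X<0 , Y<0 , e) = Y , X , Y<0 , X<0 , trans (+-comm (b * Y) (a * X)) e

  balanced-≈0 : ∀ {a b} → Balanced a b → a ≈ 0# → b ≈ 0#
  balanced-≈0 {a} {b} (X , Y , _ , (_ , Y≉0) , e) a≈0 = x*y≈0⇒x≈0 bY≈0 Y≉0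
    where
    bY≈0 : b * Y ≈ 0#
    bY≈0 = begin
      b * Y           ≈⟨ +-identityˡ (b * Y) ⟨
      0# + b * Y      ≈⟨ +-congʳ (trans (*-congʳ a≈0) (zeroˡ X)) ⟨
      a * X + b * Y   ≈⟨ e ⟩
      0#              ∎

  nonnegative-balanced⇒≈0 : ∀ {a b} → 0# ≤ a → 0# ≤ b → Balanced a b → a ≈ 0#
  nonnegative-balanced⇒≈0 {a} {b} 0≤a 0≤b (X , Y , (X≤0 , X≉0) , (Y≤0 , _) , e) =
    x*y≈0⇒x≈0 (x+y≈0⇒x≈0 (0≤x⇒x*y≤0 0≤a X≤0) (0≤x⇒x*y≤0 0≤b Y≤0) e) X≉0

  balanced-negate : ∀ {a b} → Balanced a b → Balanced (- a) (- b)
  balanced-negate {a} {b} (X , Y , X<0 , Y<0 , e) = X , Y , X<0 , Y<0 , (begin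
    - a * X + - b * Y      ≈⟨ +-cong (-‿distribˡ-* a X) (-‿distribˡ-* b Y) ⟨
    - (a * X) + - (b * Y)  ≈⟨ ⁻¹-∙-comm (a * X) (b * Y) ⟩
    - (a * X + b * Y)      ≈⟨ -‿cong e ⟩
    - 0#                   ≈⟨ ε⁻¹≈ε ⟩
    0#                     ∎)

  sameSign-balanced⇒≈0 : ∀ {a b} → SameSign a b → Balanced a b → a ≈ 0# × b ≈ 0#
  sameSign-balanced⇒≈0 (inj₁ (0≤a , 0≤b)) ab = a≈0 , balanced-≈0 ab a≈0
    where a≈0 = nonnegative-balanced⇒≈0 0≤a 0≤b ab
  sameSign-balanced⇒≈0 (inj₂ (a≤0 , b≤0)) ab = a≈0 , balanced-≈0 ab a≈0
    where a≈0 = -x≈0⇒x≈0 (nonnegative-balanced⇒≈0 (x≤0⇒0≤-x a≤0) (x≤0⇒0≤-x b≤0) (balanced-negate ab))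

  pairwise-balanced⇒≈0 : ∀ {a b c} → Balanced a b → Balanced a c → Balanced b c →
                         a ≈ 0# × b ≈ 0# × c ≈ 0#
  pairwise-balanced⇒≈0 {a} {b} {c} ab ac bc with sameSign-pigeonhole a b c
  ... | inj₁ s with sameSign-balanced⇒≈0 s ab
  ...   | a≈0 , b≈0 = a≈0 , b≈0 , balanced-≈0 ac a≈0
  pairwise-balanced⇒≈0 ab ac bc | inj₂ (inj₁ s) with sameSign-balanced⇒≈0 s ac
  ...   | a≈0 , c≈0 = a≈0 , balanced-≈0 ab a≈0 , c≈0
  pairwise-balanced⇒≈0 ab ac bc | inj₂ (inj₂ s) with sameSign-balanced⇒≈0 s bc
  ...   | b≈0 , c≈0 = balanced-≈0 (balanced-sym ab) b≈0 , b≈0 , c≈0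

module CommutativeMonoidSums {c ℓ} (M : CommutativeMonoid c ℓ) where
  open CommutativeMonoid M using (Carrier; _≈_; trans)
    renaming (_∙_ to _+_; ε to 0#; ∙-congˡ to +-congˡ; ∙-congʳ to +-congʳ;
              identityˡ to +-identityˡ; identityʳ to +-identityʳ; comm to +-comm)
  open import Algebra.Properties.CommutativeMonoid.Sum M using (sum; sum-cong-≋; sum-replicate-zero)
  open import Data.Fin.Properties using (suc-injective)

  sum-≈0 : ∀ {k} (t : Fin k → Carrier) → (∀ i → t i ≈ 0#) → sum t ≈ 0#
  sum-≈0 {k} t t≈0 = trans (sum-cong-≋ t≈0) (sum-replicate-zero k)

  sum-single : ∀ {k} (t : Fin k → Carrier) j → (∀ i → i ≢ j → t i ≈ 0#) → sum t ≈ t j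
  sum-single t F.zero t≈0 =
    trans (+-congˡ (sum-≈0 (λ i → t (F.suc i)) (λ i → t≈0 (F.suc i) λ ()))) (+-identityʳ (t F.zero))
  sum-single t (F.suc j) t≈0 =
    trans (+-congʳ (t≈0 F.zero λ ()))
      (trans (+-identityˡ _)
        (sum-single (λ i → t (F.suc i)) j (λ i i≢j → t≈0 (F.suc i) (λ e → i≢j (suc-injective e)))))

  sum-pair : ∀ {k} (t : Fin k → Carrier) j l → j ≢ l → (∀ i → i ≢ j → i ≢ l → t i ≈ 0#) → sum t ≈ t j + t l
  sum-pair t F.zero F.zero j≢l _ = ⊥-elim (j≢l refl)
  sum-pair t F.zero (F.suc l) _ t≈0 =
    +-congˡ (sum-single (λ i → t (F.suc i)) l (λ i i≢l → t≈0 (F.suc i) (λ ()) (λ e → i≢l (suc-injective e))))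
  sum-pair t (F.suc j) F.zero _ t≈0 =
    trans (+-congˡ (sum-single (λ i → t (F.suc i)) j
                     (λ i i≢j → t≈0 (F.suc i) (λ e → i≢j (suc-injective e)) (λ ()))))
          (+-comm (t F.zero) (t (F.suc j)))
  sum-pair t (F.suc j) (F.suc l) j≢l t≈0 =
    trans (+-congʳ (t≈0 F.zero (λ ()) (λ ())))
      (trans (+-identityˡ _)
        (sum-pair (λ i → t (F.suc i)) j l (λ e → j≢l (cong F.suc e))
          (λ i i≢j i≢l → t≈0 (F.suc i) (λ e → i≢j (suc-injective e)) (λ e → i≢l (suc-injective e)))))

module PolytopeGeometry (K : OrderedField) {n m : ℕ} (V : Fin m → Fin n → OrderedField.Carrier K)
                        (_⟶_ : Fin m → Fin m → Set) where
  open Polytope K V _⟶_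
  open OrderedFieldProperties K
  open OrderedField K hiding (_≤_; refl)
  open import Algebra.Properties.Semiring.Sum semiring using (sum; ∑-distrib-+; ∑-comm; *-distribˡ-sum; sum-cong-≋)
  open import Algebra.Properties.CommutativeSemigroup *-commutativeSemigroup using (x∙yz≈y∙xz)
  open import Algebra.Properties.AbelianGroup +-abelianGroup using (x∙y⁻¹≈ε⇒x≈y; x≈y⇒x∙y⁻¹≈ε)
  open CommutativeMonoidSums +-commutativeMonoid
  open IsTotalOrder isTotalOrder using (antisym; ≤-respʳ-≈)
  open import Relation.Binary.Reasoning.Setoid setoid
  open import Data.Fin.Subset.Properties using (x∈⁅x⁆; x∈⁅y⁆⇒x≡y; x∈p∪q⁺; x∈p∪q⁻; _∈?_; ⊆-antisym)
  open import Data.Fin.Patterns using (0F; 1F; 2F; 3F)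
  open import Data.Vec.Functional using ([]; _∷_)

  sumK≡sum : ∀ {k} (t : Fin k → Carrier) → sumK t ≡ sum t
  sumK≡sum {zero} t = refl
  sumK≡sum {suc k} t = cong (t F.zero +_) (sumK≡sum (λ i → t (F.suc i)))

  sumK≈sum : ∀ {k} (t : Fin k → Carrier) → sumK t ≈ sum t
  sumK≈sum t = reflexive (sumK≡sum t)

  record IsAffineDependence {k} (f : Fin (suc k) → Vertex) (l : Fin (suc k) → Carrier) : Set where
    constructor affineDependence
    field
      coefficients≈0 : sumK l ≈ 0#
      combination≈0  : ∀ j → sumK (λ i → l i * V (f i) j) ≈ 0#

  height : (Fin n → Carrier) → Vertex → Vertex → Carrier
  height c y w = dot c (V w) - dot c (V y)

  affineDependence-linear : ∀ {k} {f : Fin (suc k) → Vertex} {l} → IsAffineDependence f l →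
                            ∀ c → sum (λ i → l i * dot c (V (f i))) ≈ 0#
  affineDependence-linear {f = f} {l} (affineDependence _ ∑lV≈0) c = begin
    sum (λ i → l i * dot c (V (f i)))
      ≈⟨ sum-cong-≋ (λ i → *-congˡ {l i} (sumK≈sum (λ j → c j * V (f i) j))) ⟩
    sum (λ i → l i * sum (λ j → c j * V (f i) j))
      ≈⟨ sum-cong-≋ (λ i → *-distribˡ-sum (l i) (λ j → c j * V (f i) j)) ⟩
    sum (λ i → sum (λ j → l i * (c j * V (f i) j)))
      ≈⟨ ∑-comm (λ i j → l i * (c j * V (f i) j)) ⟩
    sum (λ j → sum (λ i → l i * (c j * V (f i) j)))
      ≈⟨ sum-cong-≋ (λ j → sum-cong-≋ (λ i → x∙yz≈y∙xz (l i) (c j) (V (f i) j))) ⟩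
    sum (λ j → sum (λ i → c j * (l i * V (f i) j)))
      ≈⟨ sum-cong-≋ (λ j → *-distribˡ-sum (c j) (λ i → l i * V (f i) j)) ⟨
    sum (λ j → c j * sum (λ i → l i * V (f i) j))
      ≈⟨ sum-≈0 _ (λ j → trans (*-congˡ (∑lV≈0′ j)) (zeroʳ (c j))) ⟩
    0# ∎
    where
    ∑lV≈0′ : ∀ j → sum (λ i → l i * V (f i) j) ≈ 0#
    ∑lV≈0′ j = trans (sym (sumK≈sum (λ i → l i * V (f i) j))) (∑lV≈0 j)

  affineDependence-constant : ∀ {k} {f : Fin (suc k) → Vertex} {l} → IsAffineDependence f l →
                              ∀ a → sum (λ i → l i * a) ≈ 0#
  affineDependence-constant {l = l} (affineDependence ∑l≈0 _) a = begin
    sum (λ i → l i * a)  ≈⟨ sum-cong-≋ (λ i → *-comm (l i) a) ⟩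
    sum (λ i → a * l i)  ≈⟨ *-distribˡ-sum a l ⟨
    a * sum l            ≈⟨ *-congˡ (trans (sym (sumK≈sum l)) ∑l≈0) ⟩
    a * 0#               ≈⟨ zeroʳ a ⟩
    0#                   ∎

  affineDependence-height : ∀ {k} {f : Fin (suc k) → Vertex} {l} → IsAffineDependence f l →
                            ∀ c y → sum (λ i → l i * height c y (f i)) ≈ 0#
  affineDependence-height {f = f} {l} dep c y = begin
    sum (λ i → l i * height c y (f i))
      ≈⟨ sum-cong-≋ (λ i → distribˡ (l i) (dot c (V (f i))) (- dot c (V y))) ⟩
    sum (λ i → l i * dot c (V (f i)) + l i * - dot c (V y))
      ≈⟨ ∑-distrib-+ (λ i → l i * dot c (V (f i))) (λ i → l i * - dot c (V y)) ⟩
    sum (λ i → l i * dot c (V (f i))) + sum (λ i → l i * - dot c (V y))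
      ≈⟨ +-cong (affineDependence-linear dep c) (affineDependence-constant dep (- dot c (V y))) ⟩
    0# + 0#
      ≈⟨ +-identityˡ 0# ⟩
    0# ∎

  IsFaceFunctional : Subset m → (Fin n → Carrier) → Set
  IsFaceFunctional S c = ∀ i →
    (i Sub.∈ S → ∀ j → dot c (V j) ≤ dot c (V i)) × ((∀ j → dot c (V j) ≤ dot c (V i)) → i Sub.∈ S)

  height-∈ : ∀ {S c y w} → IsFaceFunctional S c → y Sub.∈ S → w Sub.∈ S → height c y w ≈ 0#
  height-∈ {c = c} {y} {w} c-face y∈S w∈S =
    x≈y⇒x∙y⁻¹≈ε (antisym (proj₁ (c-face y) y∈S w) (proj₁ (c-face w) w∈S y))

  height-∉ : ∀ {S c y w} → IsFaceFunctional S c → y Sub.∈ S → w Sub.∉ S → Negative (height c y w)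
  height-∉ {c = c} {y} {w} c-face y∈S w∉S =
    ≤-respʳ-≈ (-‿inverseʳ (dot c (V y))) (+-mono-≤ (- dot c (V y)) (proj₁ (c-face y) y∈S w)) ,
    λ h≈0 → w∉S (proj₂ (c-face w) (λ j → ≤-respʳ-≈ (sym (x∙y⁻¹≈ε⇒x≈y _ _ h≈0)) (proj₁ (c-face y) y∈S j)))

  weighted-height≈0 : ∀ {S c y w} a → IsFaceFunctional S c → y Sub.∈ S → w Sub.∈ S ⊎ a ≈ 0# → a * height c y w ≈ 0#
  weighted-height≈0 a c-face y∈S (inj₁ w∈S) = trans (*-congˡ (height-∈ c-face y∈S w∈S)) (zeroʳ a)
  weighted-height≈0 a c-face y∈S (inj₂ a≈0) = trans (*-congʳ a≈0) (zeroˡ _)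

  affineDependence-one-outside : ∀ {S y k} {f : Fin (suc k) → Vertex} {l} j →
    IsFace S → y Sub.∈ S → IsAffineDependence f l → f j Sub.∉ S →
    (∀ i → f i Sub.∈ S ⊎ l i ≈ 0# ⊎ i ≡ j) → l j ≈ 0#
  affineDependence-one-outside {y = y} {f = f} {l} j (c , c-face) y∈S dep fj∉S others =
    x*y≈0⇒x≈0 (trans (sym (sum-single _ j vanishes)) (affineDependence-height dep c y))
              (proj₂ (height-∉ c-face y∈S fj∉S))
    where
    vanishes : ∀ i → i ≢ j → l i * height c y (f i) ≈ 0#
    vanishes i i≢j with others i
    ... | inj₁ fi∈S        = weighted-height≈0 (l i) c-face y∈S (inj₁ fi∈S)
    ... | inj₂ (inj₁ li≈0) = weighted-height≈0 (l i) c-face y∈S (inj₂ li≈0)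
    ... | inj₂ (inj₂ i≡j)  = ⊥-elim (i≢j i≡j)

  affineDependence-two-outside : ∀ {S y k} {f : Fin (suc k) → Vertex} {l} j j′ → j ≢ j′ →
    IsFace S → y Sub.∈ S → IsAffineDependence f l → f j Sub.∉ S → f j′ Sub.∉ S →
    (∀ i → f i Sub.∈ S ⊎ i ≡ j ⊎ i ≡ j′) → Balanced (l j) (l j′)
  affineDependence-two-outside {y = y} {f = f} {l} j j′ j≢j′ (c , c-face) y∈S dep fj∉S fj′∉S others =
    height c y (f j) , height c y (f j′) , height-∉ c-face y∈S fj∉S , height-∉ c-face y∈S fj′∉S ,
    trans (sym (sum-pair _ j j′ j≢j′ vanishes)) (affineDependence-height dep c y)
    where
    vanishes : ∀ i → i ≢ j → i ≢ j′ → l i * height c y (f i) ≈ 0#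
    vanishes i i≢j i≢j′ with others i
    ... | inj₁ fi∈S        = weighted-height≈0 (l i) c-face y∈S (inj₁ fi∈S)
    ... | inj₂ (inj₁ i≡j)  = ⊥-elim (i≢j i≡j)
    ... | inj₂ (inj₂ i≡j′) = ⊥-elim (i≢j′ i≡j′)

  affineDependence-remaining≈0 : ∀ {k} {f : Fin (suc k) → Vertex} {l} j → IsAffineDependence f l →
                          (∀ i → i ≢ j → l i ≈ 0#) → l j ≈ 0#
  affineDependence-remaining≈0 {l = l} j (affineDependence ∑l≈0 _) others =
    trans (sym (trans (sumK≈sum l) (sum-single l j others))) ∑l≈0

  ∈-edgeˡ : ∀ (y z : Vertex) → y Sub.∈ ⁅ y ⁆ ∪ ⁅ z ⁆
  ∈-edgeˡ y z = x∈p∪q⁺ (inj₁ (x∈⁅x⁆ y))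

  ∈-edgeʳ : ∀ (y z : Vertex) → z Sub.∈ ⁅ y ⁆ ∪ ⁅ z ⁆
  ∈-edgeʳ y z = x∈p∪q⁺ (inj₂ (x∈⁅x⁆ z))

  ∉-edge : ∀ {y z w : Vertex} → w ≢ y → w ≢ z → w Sub.∉ ⁅ y ⁆ ∪ ⁅ z ⁆
  ∉-edge {y} {z} w≢y w≢z w∈ with x∈p∪q⁻ ⁅ y ⁆ ⁅ z ⁆ w∈
  ... | inj₁ w∈y = w≢y (x∈⁅y⁆⇒x≡y y w∈y)
  ... | inj₂ w∈z = w≢z (x∈⁅y⁆⇒x≡y z w∈z)

  -- the edges y z₁, y z₂, y z₃ together would make y, z₁, z₂, z₃ affinely independent
  twoFace-at-most-two-neighbours : ∀ {G y z₁ z₂ z₃} → HasDim G 2 →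
    y Sub.∈ G → z₁ Sub.∈ G → z₂ Sub.∈ G → z₃ Sub.∈ G →
    IsFace (⁅ y ⁆ ∪ ⁅ z₁ ⁆) → IsFace (⁅ y ⁆ ∪ ⁅ z₂ ⁆) → IsFace (⁅ y ⁆ ∪ ⁅ z₃ ⁆) →
    z₁ ≢ y → z₂ ≢ y → z₃ ≢ y → z₁ ≢ z₂ → z₁ ≢ z₃ → z₂ ≢ z₃ → ⊥
  twoFace-at-most-two-neighbours {G} {y} {z₁} {z₂} {z₃} dim y∈G z₁∈G z₂∈G z₃∈G yz₁ yz₂ yz₃
                                 z₁≢y z₂≢y z₃≢y z₁≢z₂ z₁≢z₃ z₂≢z₃ =
    proj₂ dim points members independent
    where
    points : Fin 4 → Vertex
    points = y ∷ z₁ ∷ z₂ ∷ z₃ ∷ []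
    members : ∀ i → points i Sub.∈ G
    members 0F = y∈G
    members 1F = z₁∈G
    members 2F = z₂∈G
    members 3F = z₃∈G
    independent : AffIndep points
    independent l ∑l≈0 ∑lV≈0 = coefficients
      where
      dep : IsAffineDependence points l
      dep = affineDependence ∑l≈0 ∑lV≈0
      balanced₁₂ : Balanced (l 1F) (l 2F)
      balanced₁₂ = affineDependence-two-outside 1F 2F (λ ()) yz₃ (∈-edgeˡ y z₃) dep
        (∉-edge z₁≢y z₁≢z₃) (∉-edge z₂≢y z₂≢z₃)
        λ { 0F → inj₁ (∈-edgeˡ y z₃) ; 1F → inj₂ (inj₁ refl) ; 2F → inj₂ (inj₂ refl) ; 3F → inj₁ (∈-edgeʳ y z₃) }
      balanced₁₃ : Balanced (l 1F) (l 3F)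
      balanced₁₃ = affineDependence-two-outside 1F 3F (λ ()) yz₂ (∈-edgeˡ y z₂) dep
        (∉-edge z₁≢y z₁≢z₂) (∉-edge z₃≢y (λ e → z₂≢z₃ (≡.sym e)))
        λ { 0F → inj₁ (∈-edgeˡ y z₂) ; 1F → inj₂ (inj₁ refl) ; 2F → inj₁ (∈-edgeʳ y z₂) ; 3F → inj₂ (inj₂ refl) }
      balanced₂₃ : Balanced (l 2F) (l 3F)
      balanced₂₃ = affineDependence-two-outside 2F 3F (λ ()) yz₁ (∈-edgeˡ y z₁) dep
        (∉-edge z₂≢y (λ e → z₁≢z₂ (≡.sym e))) (∉-edge z₃≢y (λ e → z₁≢z₃ (≡.sym e)))
        λ { 0F → inj₁ (∈-edgeˡ y z₁) ; 1F → inj₁ (∈-edgeʳ y z₁) ; 2F → inj₂ (inj₁ refl) ; 3F → inj₂ (inj₂ refl) }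
      l₁≈0 = proj₁ (pairwise-balanced⇒≈0 balanced₁₂ balanced₁₃ balanced₂₃)
      l₂≈0 = proj₁ (proj₂ (pairwise-balanced⇒≈0 balanced₁₂ balanced₁₃ balanced₂₃))
      l₃≈0 = proj₂ (proj₂ (pairwise-balanced⇒≈0 balanced₁₂ balanced₁₃ balanced₂₃))
      coefficients : ∀ i → l i ≈ 0#
      coefficients 0F = affineDependence-remaining≈0 0F dep
        λ { 0F 0≢0 → ⊥-elim (0≢0 refl) ; 1F _ → l₁≈0 ; 2F _ → l₂≈0 ; 3F _ → l₃≈0 }
      coefficients 1F = l₁≈0
      coefficients 2F = l₂≈0
      coefficients 3F = l₃≈0

  -- a vertex q ∈ G outside G′ would make q, w, y, s affinely independent
  twoFace-⊆ : ∀ {G G′ w y s} → HasDim G 2 → IsFace G′ →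
    w Sub.∈ G → y Sub.∈ G → s Sub.∈ G → w Sub.∈ G′ → y Sub.∈ G′ → s Sub.∈ G′ →
    IsFace (⁅ w ⁆ ∪ ⁅ y ⁆) → IsFace (⁅ y ⁆ ∪ ⁅ s ⁆) → s ≢ w → s ≢ y → w ≢ y → G Sub.⊆ G′
  twoFace-⊆ {G} {G′} {w} {y} {s} dim G′-face w∈G y∈G s∈G w∈G′ y∈G′ s∈G′ wy ys s≢w s≢y w≢y {q} q∈G
    with q ∈? G′
  ... | yes q∈G′ = q∈G′
  ... | no q∉G′ = ⊥-elim (proj₂ dim points members independent)
    where
    points : Fin 4 → Vertex
    points = q ∷ w ∷ y ∷ s ∷ []
    members : ∀ i → points i Sub.∈ G
    members 0F = q∈G
    members 1F = w∈G
    members 2F = y∈G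
    members 3F = s∈G
    independent : AffIndep points
    independent l ∑l≈0 ∑lV≈0 = coefficients
      where
      dep : IsAffineDependence points l
      dep = affineDependence ∑l≈0 ∑lV≈0
      l₀≈0 : l 0F ≈ 0#
      l₀≈0 = affineDependence-one-outside 0F G′-face y∈G′ dep q∉G′
        λ { 0F → inj₂ (inj₂ refl) ; 1F → inj₁ w∈G′ ; 2F → inj₁ y∈G′ ; 3F → inj₁ s∈G′ }
      l₃≈0 : l 3F ≈ 0#
      l₃≈0 = affineDependence-one-outside 3F wy (∈-edgeʳ w y) dep (∉-edge s≢w s≢y)
        λ { 0F → inj₂ (inj₁ l₀≈0) ; 1F → inj₁ (∈-edgeˡ w y) ; 2F → inj₁ (∈-edgeʳ w y) ; 3F → inj₂ (inj₂ refl) }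
      l₁≈0 : l 1F ≈ 0#
      l₁≈0 = affineDependence-one-outside 1F ys (∈-edgeˡ y s) dep (∉-edge w≢y (λ e → s≢w (≡.sym e)))
        λ { 0F → inj₂ (inj₁ l₀≈0) ; 1F → inj₂ (inj₂ refl) ; 2F → inj₁ (∈-edgeˡ y s) ; 3F → inj₁ (∈-edgeʳ y s) }
      coefficients : ∀ i → l i ≈ 0#
      coefficients 0F = l₀≈0
      coefficients 1F = l₁≈0
      coefficients 2F = affineDependence-remaining≈0 2F dep
        λ { 0F _ → l₀≈0 ; 1F _ → l₁≈0 ; 2F 2≢2 → ⊥-elim (2≢2 refl) ; 3F _ → l₃≈0 }
      coefficients 3F = l₃≈0

  twoFace-unique : ∀ {G G′ w y s} → IsFace G → HasDim G 2 → IsFace G′ → HasDim G′ 2 →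
    w Sub.∈ G → y Sub.∈ G → s Sub.∈ G → w Sub.∈ G′ → y Sub.∈ G′ → s Sub.∈ G′ →
    IsFace (⁅ w ⁆ ∪ ⁅ y ⁆) → IsFace (⁅ y ⁆ ∪ ⁅ s ⁆) → s ≢ w → s ≢ y → w ≢ y → G ≡ G′
  twoFace-unique G-face G-dim G′-face G′-dim w∈G y∈G s∈G w∈G′ y∈G′ s∈G′ wy ys s≢w s≢y w≢y =
    ⊆-antisym (twoFace-⊆ G-dim G′-face w∈G y∈G s∈G w∈G′ y∈G′ s∈G′ wy ys s≢w s≢y w≢y)
              (twoFace-⊆ G′-dim G-face w∈G′ y∈G′ s∈G′ w∈G y∈G s∈G wy ys s≢w s≢y w≢y)

module ListProperties {A : Set} where
  open import Data.List using (List; []; _∷_; _++_; _∷ʳ_; length)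
  open import Data.List.Properties using (∷-injective; ∷-injectiveˡ; ∷-injectiveʳ; ++-assoc; ++-cancelˡ; ∷ʳ-injective; ∷ʳ-++)
  open import Data.Nat using (_<_; s≤s; z≤n)
  open import Data.List.Membership.Propositional using (_∈_)
  open import Data.List.Membership.Propositional.Properties using (∈-++⁺ʳ)
  open import Data.List.Relation.Unary.Any using (here)
  open import Data.List.Relation.Unary.All as All using (All; []; _∷_)
  import Data.List.Relation.Unary.All.Properties as AllP
  open import Data.List.Relation.Unary.Unique.Propositional using (Unique)
  open import Data.List.Relation.Unary.AllPairs using ([]; _∷_)

  ++-∷-cases : ∀ (Q P : List A) {X a R} → Q ++ X ≡ P ++ a ∷ R →
               (∃ λ Z → P ≡ Q ++ Z) ⊎ (∃ λ Z → Q ≡ P ++ a ∷ Z)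
  ++-∷-cases []      P       e = inj₁ (P , refl)
  ++-∷-cases (q ∷ Q) []      e with ∷-injective e
  ... | refl , _ = inj₂ (Q , refl)
  ++-∷-cases (q ∷ Q) (p ∷ P) e with ∷-injective e
  ... | refl , e′ with ++-∷-cases Q P e′
  ...   | inj₁ (Z , P≡QZ) = inj₁ (Z , cong (q ∷_) P≡QZ)
  ...   | inj₂ (Z , Q≡PaZ) = inj₂ (Z , cong (q ∷_) Q≡PaZ)

  unique-split-injective : ∀ (xs xs′ : List A) {z ys ys′} → Unique (xs ++ z ∷ ys) →
                           xs ++ z ∷ ys ≡ xs′ ++ z ∷ ys′ → xs ≡ xs′ × ys ≡ ys′
  unique-split-injective []       []        _            e = refl , ∷-injectiveʳ e
  unique-split-injective []       (x ∷ xs′) (z∉ ∷ _)     e with ∷-injective e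
  ... | refl , ys≡ = ⊥-elim (All.lookup z∉ (≡.subst (_ ∈_) (≡.sym ys≡) (∈-++⁺ʳ xs′ (here refl))) refl)
  unique-split-injective (x ∷ xs) []        (z∉ ∷ _)     e with ∷-injective e
  ... | refl , _ = ⊥-elim (All.lookup z∉ (∈-++⁺ʳ xs (here refl)) refl)
  unique-split-injective (x ∷ xs) (x′ ∷ xs′) (_ ∷ unique) e with ∷-injective e
  ... | refl , e′ with unique-split-injective xs xs′ unique e′
  ...   | refl , ys≡ys′ = refl , ys≡ys′

  same-head : ∀ (W : List A) {a b x X Y Z Z′} → a ∷ Z ≡ W ++ x ∷ X → b ∷ Z′ ≡ W ++ x ∷ Y → a ≡ b
  same-head []      refl refl = refl
  same-head (_ ∷ _) refl refl = refl

  BranchesOff : List A → List A → List A × A × A → Set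
  BranchesOff γ δ (W , y , s) = ∃₂ λ g r → ∃ λ r′ → γ ≡ W ++ y ∷ g ∷ r × δ ≡ W ++ y ∷ s ∷ r′ × s ≢ g

  branchesOff-unique : ∀ {γ δ} W W′ {y y′ s s′} →
    BranchesOff γ δ (W , y , s) → BranchesOff γ δ (W′ , y′ , s′) → (W , y , s) ≡ (W′ , y′ , s′)
  branchesOff-unique [] [] (_ , _ , _ , refl , refl , _) (_ , _ , _ , γ≡ , δ≡ , _)
    with ∷-injective γ≡ | ∷-injective δ≡
  ... | refl , _ | refl , δ≡′ = cong (λ s → [] , _ , s) (∷-injectiveˡ δ≡′)
  branchesOff-unique [] (_ ∷ W′) (_ , _ , _ , refl , refl , s≢g) (_ , _ , _ , γ≡ , δ≡ , _) =
    ⊥-elim (s≢g (same-head W′ (∷-injectiveʳ δ≡) (∷-injectiveʳ γ≡)))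
  branchesOff-unique (_ ∷ W) [] (_ , _ , _ , γ≡ , δ≡ , _) (_ , _ , _ , refl , refl , s′≢g′) =
    ⊥-elim (s′≢g′ (same-head W (∷-injectiveʳ δ≡) (∷-injectiveʳ γ≡)))
  branchesOff-unique (_ ∷ W) (_ ∷ W′) (g , r , r′ , γ≡ , δ≡ , s≢g) (g′ , q , q′ , γ≡′ , δ≡′ , s′≢g′)
    with ∷-injective (≡.trans (≡.sym γ≡) γ≡′) | ∷-injective (≡.trans (≡.sym δ≡) δ≡′)
  ... | refl , γ≡″ | _ , δ≡″
    with branchesOff-unique W W′ (g , r , r′ , refl , refl , s≢g) (g′ , q , q′ , γ≡″ , δ≡″ , s′≢g′)
  ...   | refl = refl

  branchesOff-∷ : ∀ {γ δ W y s} x → BranchesOff γ δ (W , y , s) → BranchesOff (x ∷ γ) (x ∷ δ) (x ∷ W , y , s)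
  branchesOff-∷ x (g , r , r′ , refl , refl , s≢g) = g , r , r′ , refl , refl , s≢g

  branchesOff-beyond-common-prefix : ∀ {γ δ} Q {X Y W y s} → γ ≡ Q ++ X → δ ≡ Q ++ Y →
    BranchesOff γ δ (W , y , s) → ∃ λ Z → W ∷ʳ y ≡ Q ++ Z
  branchesOff-beyond-common-prefix {δ = δ} Q {X} {Y} {W} {y} {s} refl δ≡QY (g , r , r′ , γ≡ , δ≡ , s≢g)
    with ++-∷-cases Q (W ∷ʳ y) (≡.trans γ≡ (≡.sym (∷ʳ-++ W y (g ∷ r))))
  ... | inj₁ (Z , e) = Z , e
  ... | inj₂ (Z , refl) = ⊥-elim (s≢g (∷-injectiveˡ (++-cancelˡ (W ∷ʳ y) _ _ (begin
    (W ∷ʳ y) ++ s ∷ r′           ≡⟨ ∷ʳ-++ W y (s ∷ r′) ⟩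
    W ++ y ∷ s ∷ r′              ≡⟨ δ≡ ⟨
    δ                            ≡⟨ δ≡QY ⟩
    ((W ∷ʳ y) ++ g ∷ Z) ++ Y     ≡⟨ ++-assoc (W ∷ʳ y) (g ∷ Z) Y ⟩
    (W ∷ʳ y) ++ g ∷ Z ++ Y       ∎))))
    where open ≡.≡-Reasoning

  prefix-length-< : ∀ (W W₂ : List A) {y₂ y g Z} → W₂ ∷ʳ y₂ ≡ W ++ y ∷ g ∷ Z → length W < length W₂
  prefix-length-< []      []       e with ∷-injectiveʳ e
  ... | ()
  prefix-length-< []      (_ ∷ _)  e = s≤s z≤n
  prefix-length-< (_ ∷ W) []       e with W | ∷-injectiveʳ e
  ... | []    | ()
  ... | _ ∷ _ | ()
  prefix-length-< (_ ∷ W) (_ ∷ W₂) e = s≤s (prefix-length-< W W₂ (∷-injectiveʳ e))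

  last-two : ∀ (a b : A) T → ∃₂ λ P w → ∃ λ z → a ∷ b ∷ T ≡ P ++ w ∷ z ∷ []
  last-two a b []      = [] , a , b , refl
  last-two a b (c ∷ T) with last-two b c T
  ... | P , w , z , e = a ∷ P , w , z , cong (a ∷_) e

  ∷ʳ≡-last-two : ∀ {P : A → Set} W W₂ {a b T y₂} → W₂ ∷ʳ y₂ ≡ W ++ a ∷ b ∷ T → All P (a ∷ b ∷ T) →
                 ∃₂ λ Q w → W₂ ≡ Q ∷ʳ w × P w × P y₂
  ∷ʳ≡-last-two {P} W W₂ {a} {b} {T} {y₂} e all with last-two a b T
  ... | R , w , z , abT≡ with ∷ʳ-injective W₂ ((W ++ R) ∷ʳ w) (≡.trans e W-abT≡)
    where
    W-abT≡ : W ++ a ∷ b ∷ T ≡ ((W ++ R) ∷ʳ w) ∷ʳ z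
    W-abT≡ = ≡.trans (cong (W ++_) abT≡)
               (≡.trans (≡.sym (++-assoc W R (w ∷ z ∷ []))) (≡.sym (++-assoc (W ++ R) (w ∷ []) (z ∷ []))))
  ...   | refl , refl with AllP.++⁻ʳ R (≡.subst (All P) abT≡ all)
  ...     | Pw ∷ Pz ∷ [] = W ++ R , w , refl , Pw , Pz

module DeterministicStar {A : Set} (_⇝_ : A → A → Set) (rank : A → ℕ)
                         (rank-decreasing : ∀ {x y} → x ⇝ y → rank y ℕ.< rank x)
                         (deterministic : Deterministic _≡_ _⇝_) where
  open import Data.Nat.Properties using (≤-refl; ≤-trans; <⇒≤; <-irrefl; ≤-<-trans)
  open import Relation.Binary.Construct.Closure.ReflexiveTransitive using (Star; ε; _◅_)

  star-rank-antitone : ∀ {x y} → Star _⇝_ x y → rank y ℕ.≤ rank x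
  star-rank-antitone ε          = ≤-refl
  star-rank-antitone (x⇝ ◅ ⇝*y) = ≤-trans (star-rank-antitone ⇝*y) (<⇒≤ (rank-decreasing x⇝))

  star-rank-injective : ∀ {z x y} → Star _⇝_ z x → Star _⇝_ z y → rank x ≡ rank y → x ≡ y
  star-rank-injective ε           ε           _  = refl
  star-rank-injective ε           (z⇝ ◅ ⇝*y)  rx≡ry =
    ⊥-elim (<-irrefl (≡.sym rx≡ry) (≤-<-trans (star-rank-antitone ⇝*y) (rank-decreasing z⇝)))
  star-rank-injective (z⇝ ◅ ⇝*x)  ε           rx≡ry =
    ⊥-elim (<-irrefl rx≡ry (≤-<-trans (star-rank-antitone ⇝*x) (rank-decreasing z⇝)))
  star-rank-injective (z⇝x′ ◅ ⇝*x) (z⇝y′ ◅ ⇝*y) rx≡ry with deterministic z⇝x′ z⇝y′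
  ... | refl = star-rank-injective ⇝*x ⇝*y rx≡ry

module Chains (K : OrderedField) {n m : ℕ} (V : Fin m → Fin n → OrderedField.Carrier K)
              (_⟶_ : Fin m → Fin m → Set) where
  open Polytope K V _⟶_
  open ListProperties {Vertex}
  open import Data.List using (List; []; _∷_; _++_; _∷ʳ_)
  open import Data.List.Properties using (++-assoc)
  open import Data.List.Membership.Propositional using (_∈_)
  open import Data.List.Relation.Unary.Any using (here; there)
  open import Data.List.Relation.Unary.All as All using ()
  open import Data.List.Relation.Unary.Unique.Propositional using (Unique)
  open import Data.List.Relation.Unary.AllPairs using ([]; _∷_)
  open import Relation.Binary.Construct.Closure.Transitive using (TransClosure; [_]; _∷_)
    renaming (_∷ʳ_ to _⁺∷ʳ_)
  open import Relation.Binary.Construct.Closure.ReflexiveTransitive using (ε; _◅_)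

  chain-head : ∀ {a b xs} → Chain a b xs → ∃ λ ys → xs ≡ a ∷ ys
  chain-head (single _)  = _ , refl
  chain-head (cover _ _) = _ , refl

  chain-last : ∀ {a b xs} → Chain a b xs → ∃ λ ys → xs ≡ ys ∷ʳ b
  chain-last (single x) = [] , refl
  chain-last (cover {x = x} _ c) with chain-last c
  ... | ys , refl = x ∷ ys , refl

  chain-reachable : ∀ {a b ys z} → Chain a b (a ∷ ys) → z ∈ ys → TransClosure _⟶_ a z
  chain-reachable (cover a⟶y (single _))    (here refl) = [ a⟶y ]
  chain-reachable (cover a⟶y (cover _ _))   (here refl) = [ a⟶y ]
  chain-reachable (cover a⟶y c@(cover _ _)) (there z∈)  = a⟶y ∷ chain-reachable c z∈

  chain-suffix : ∀ xs {a b y ys} → Chain a b (xs ++ y ∷ ys) → Chain y b (y ∷ ys)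
  chain-suffix []            c@(single _)  = c
  chain-suffix []            c@(cover _ _) = c
  chain-suffix (_ ∷ [])      (cover _ c)   = chain-suffix [] c
  chain-suffix (_ ∷ x ∷ xs)  (cover _ c)   = chain-suffix (x ∷ xs) c

  chain-edge : ∀ xs {a b w y ys} → Chain a b (xs ++ w ∷ y ∷ ys) → w ⟶ y
  chain-edge xs c with chain-suffix xs c
  ... | cover w⟶ c′ with chain-head c′
  ...   | _ , refl = w⟶

  chain-++ : ∀ {a b c xs ys} → Chain a b xs → Chain b c (b ∷ ys) → Chain a c (xs ++ ys)
  chain-++ (single _)  d = d
  chain-++ (cover h c) d = cover h (chain-++ c d)

  chain-replace : ∀ P {a b c r t B} → Chain a b (P ++ c ∷ r) → Chain c t B → Chain a t (P ++ B)
  chain-replace []           c@(single _)  d = d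
  chain-replace []           c@(cover _ _) d = d
  chain-replace (_ ∷ [])     (cover h c)   d = cover h (chain-replace [] c d)
  chain-replace (_ ∷ x ∷ P)  (cover h c)   d = cover h (chain-replace (x ∷ P) c d)

  moved-chain : ∀ P {a v c r t B p′} → Chain a v (P ++ c ∷ r) → Chain c t B → Chain t v (t ∷ p′) →
                Chain a v (P ++ B ++ p′)
  moved-chain P {B = B} {p′} c b p = ≡.subst (Chain _ _) (++-assoc P B p′) (chain-++ (chain-replace P c b) p)

  cover-⁺ : ∀ {a y b ys} → a ⟶ y → Chain y b ys → TransClosure _⟶_ a b
  cover-⁺ a⟶y (single _)    = [ a⟶y ]
  cover-⁺ a⟶y (cover y⟶ c) = a⟶y ∷ cover-⁺ y⟶ c

  ⁺-◅◅ : ∀ {a b c} → TransClosure _⟶_ a b → b ≤L c → TransClosure _⟶_ a c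
  ⁺-◅◅ a⟶⁺b ε           = a⟶⁺b
  ⁺-◅◅ a⟶⁺b (b⟶ ◅ ⟶*c) = ⁺-◅◅ (a⟶⁺b ⁺∷ʳ b⟶) ⟶*c

  module _ (acyclic : Acyclic) where

    chain-unique : ∀ {a b xs} → Chain a b xs → Unique xs
    chain-unique (single _)  = All.[] ∷ []
    chain-unique (cover h c) =
      All.tabulate (λ z∈ a≡z →
        acyclic _ (≡.subst (TransClosure _⟶_ _) (≡.sym a≡z) (chain-reachable (cover h c) z∈)))
      ∷ chain-unique c

    chain-split-injective : ∀ {a b L} xs xs′ {z ys ys′} → Chain a b L →
                            L ≡ xs ++ z ∷ ys → L ≡ xs′ ++ z ∷ ys′ → xs ≡ xs′ × ys ≡ ys′
    chain-split-injective xs xs′ c refl e = unique-split-injective xs xs′ (chain-unique c) e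

    branching-exists : ∀ {u v γ δ} → Chain u v γ → Chain u v δ → γ ≢ δ → ∃ (BranchesOff γ δ)
    branching-exists (single _)    (single _)    γ≢δ = ⊥-elim (γ≢δ refl)
    branching-exists (single _)    (cover u⟶ c)  _   = ⊥-elim (acyclic _ (cover-⁺ u⟶ c))
    branching-exists (cover u⟶ c)  (single _)    _   = ⊥-elim (acyclic _ (cover-⁺ u⟶ c))
    branching-exists (cover {y = y} _ c) (cover {y = y′} _ c′) γ≢δ
      with y F.≟ y′ | chain-head c | chain-head c′
    ... | no y≢y′  | r , refl | r′ , refl = ([] , _ , y′) , y , r , r′ , refl , refl , λ e → y≢y′ (≡.sym e)
    ... | yes refl | _ | _ with branching-exists c c′ (λ e → γ≢δ (cong (_ ∷_) e))
    ...   | (W , y₀ , s) , branches = (_ ∷ W , y₀ , s) , branchesOff-∷ _ branches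

module Moves (K : OrderedField) {n m : ℕ} (V : Fin m → Fin n → OrderedField.Carrier K)
             (_⟶_ : Fin m → Fin m → Set) where
  open Polytope K V _⟶_
  open PolytopeGeometry K V _⟶_ using (twoFace-at-most-two-neighbours; twoFace-unique)
  open Chains K V _⟶_
  open ListProperties {Vertex}
  open import Data.List using (List; []; _∷_; _++_; _∷ʳ_; length)
  open import Data.List.Properties using (∷-injective; ∷-injectiveˡ; ++-assoc; ++-cancelˡ; ∷ʳ-injective; ∷ʳ-++)
  open import Data.List.Membership.Propositional using (_∈_)
  open import Data.List.Membership.Propositional.Properties using (∈-++⁺ˡ; ∈-++⁺ʳ; ∈-++⁻)
  open import Data.List.Relation.Unary.Any using (here)
  open import Data.List.Relation.Unary.All as All using (All; _∷_)
  import Data.List.Relation.Unary.All.Properties as AllP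
  open import Data.Fin.Subset.Properties using (∪-comm)
  open import Relation.Binary.Construct.Closure.ReflexiveTransitive using (Star; ε; _◅_; _◅◅_)
  open ≡.≡-Reasoning

  first-node : ∀ {v δ₁ δ₂ ns} → Star* v δ₁ δ₂ ns → δ₁ ∈ ns
  first-node (trivial _) = here refl
  first-node (step _ _ _ _ _ _ _ _ _ _ _ _ _ _ _ _ _ _ _ _ _ _ _ _ _ _ _ _ _ moves₁ _) = ∈-++⁺ˡ (first-node moves₁)

  module _ (orientation : IsOrientation) (acyclic : Acyclic) (facial : Facial) where

    edge-face : ∀ {i j} → i ⟶ j → IsFace (⁅ i ⁆ ∪ ⁅ j ⁆)
    edge-face {i} {j} i⟶j = proj₁ (proj₁ orientation i j i⟶j)

    edge-face′ : ∀ {i j} → i ⟶ j → IsFace (⁅ j ⁆ ∪ ⁅ i ⁆)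
    edge-face′ {i} {j} i⟶j = ≡.subst IsFace (∪-comm ⁅ i ⁆ ⁅ j ⁆) (edge-face i⟶j)

    ⟶-asym : ∀ {i j} → i ⟶ j → ¬ (j ⟶ i)
    ⟶-asym {i} {j} = proj₂ (proj₂ orientation) i j

    ⟶⇒≢ : ∀ {i j} → i ⟶ j → i ≢ j
    ⟶⇒≢ i⟶j refl = ⟶-asym i⟶j i⟶j

    -- an edge z ⟶ y inside F would give y a third neighbour in F
    twoFace-source : ∀ {F y g s} → HasDim F 2 → y Sub.∈ F → g Sub.∈ F → s Sub.∈ F →
                     y ⟶ g → y ⟶ s → g ≢ s → IsSource F y
    twoFace-source dim y∈F g∈F s∈F y⟶g y⟶s g≢s = y∈F , λ z z∈F z⟶y →
      twoFace-at-most-two-neighbours dim y∈F z∈F g∈F s∈F (edge-face′ z⟶y) (edge-face y⟶g) (edge-face y⟶s)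
        (⟶⇒≢ z⟶y) (≡.≢-sym (⟶⇒≢ y⟶g)) (≡.≢-sym (⟶⇒≢ y⟶s))
        (λ { refl → ⟶-asym z⟶y y⟶g }) (λ { refl → ⟶-asym z⟶y y⟶s }) g≢s

    source-unique : ∀ {F y y′} → IsFace F → IsSource F y → IsSource F y′ → y ≡ y′
    source-unique F-face src src′ with proj₁ (facial _ F-face)
    ... | _ , _ , unique = ≡.trans (unique _ src) (≡.sym (unique _ src′))

    successor-prefix : ∀ {a v δ α x a′ β P r} → Chain a v δ →
                       δ ≡ α ++ x ∷ a′ ∷ β → δ ≡ P ++ a′ ∷ r → P ≡ α ∷ʳ x
    successor-prefix {α = α} {x} {a′} {β} {P} δ-chain δ≡ δ≡′ =
      ≡.sym (proj₁ (chain-split-injective acyclic (α ∷ʳ x) P δ-chain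
                      (≡.trans δ≡ (≡.sym (∷ʳ-++ α x (a′ ∷ β)))) δ≡′))

    -- x cannot lie above the first branching y of the two chains, since x ≤ y
    move-position : ∀ {u v δ₁ δ₂ x a₁ a₂ α α′ β β′} → Chain u v δ₁ → Chain u v δ₂ → δ₁ ≢ δ₂ →
      δ₁ ≡ α ++ x ∷ a₁ ∷ β → δ₂ ≡ α′ ++ x ∷ a₂ ∷ β′ →
      (∀ y c₁ c₂ → y ∈ δ₁ → y ∈ δ₂ → Succ δ₁ y c₁ → Succ δ₂ y c₂ → c₁ ≢ c₂ → x ≤L y) → α ≡ α′
    move-position {δ₁ = δ₁} {δ₂} {x} {a₁} {a₂} {α} {α′} {β} {β′} δ₁-chain δ₂-chain δ₁≢δ₂ δ₁≡ δ₂≡ minimal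
      with branching-exists acyclic δ₁-chain δ₂-chain δ₁≢δ₂
    ... | (W , y , s) , g , r , r′ , δ₁≡W , δ₂≡W , s≢g
      with ++-∷-cases (W ∷ʳ y) α (≡.trans (∷ʳ-++ W y (g ∷ r)) (≡.trans (≡.sym δ₁≡W) δ₁≡))
    ... | inj₁ (Z , refl) = ⊥-elim (acyclic y (⁺-◅◅ y⟶⁺x x≤y))
      where
      δ₁≡′ : δ₁ ≡ W ++ y ∷ (Z ++ x ∷ a₁ ∷ β)
      δ₁≡′ = begin
        δ₁                                  ≡⟨ δ₁≡ ⟩
        ((W ∷ʳ y) ++ Z) ++ x ∷ a₁ ∷ β       ≡⟨ ++-assoc (W ∷ʳ y) Z _ ⟩
        (W ∷ʳ y) ++ Z ++ x ∷ a₁ ∷ β         ≡⟨ ∷ʳ-++ W y _ ⟩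
        W ++ y ∷ (Z ++ x ∷ a₁ ∷ β)          ∎
      y⟶⁺x = chain-reachable (chain-suffix W (≡.subst (Chain _ _) δ₁≡′ δ₁-chain)) (∈-++⁺ʳ Z (here refl))
      x≤y = minimal y g s (≡.subst (y ∈_) (≡.sym δ₁≡W) (∈-++⁺ʳ W (here refl)))
                          (≡.subst (y ∈_) (≡.sym δ₂≡W) (∈-++⁺ʳ W (here refl)))
                          (W , r , δ₁≡W) (W , r′ , δ₂≡W) (≡.≢-sym s≢g)
    ... | inj₂ (Z , W∷ʳy≡) = proj₁ (chain-split-injective acyclic α α′ δ₂-chain δ₂≡″ δ₂≡)
      where
      δ₂≡″ : δ₂ ≡ α ++ x ∷ (Z ++ s ∷ r′)
      δ₂≡″ = begin
        δ₂                          ≡⟨ δ₂≡W ⟩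
        W ++ y ∷ s ∷ r′             ≡⟨ ∷ʳ-++ W y _ ⟨
        (W ∷ʳ y) ++ s ∷ r′          ≡⟨ cong (_++ s ∷ r′) W∷ʳy≡ ⟩
        (α ++ x ∷ Z) ++ s ∷ r′      ≡⟨ ++-assoc α (x ∷ Z) _ ⟩
        α ++ x ∷ (Z ++ s ∷ r′)      ∎

    successor-beyond-common-prefix : ∀ {a₀ a₀′ v δ₁ δ₂} Q {X Y x a₁ a₂ α β α′ β′ P r} →
      Chain a₀ v δ₁ → Chain a₀′ v δ₂ → δ₁ ≡ Q ++ X → δ₂ ≡ Q ++ Y →
      δ₁ ≡ α ++ x ∷ a₁ ∷ β → δ₂ ≡ α′ ++ x ∷ a₂ ∷ β′ → a₁ ≢ a₂ → δ₁ ≡ P ++ a₁ ∷ r → ∃ λ Z → P ≡ Q ++ Z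
    successor-beyond-common-prefix {δ₂ = δ₂} Q {X} {Y} {x} {a₁} {a₂} {α} {β} {α′}
                                   δ₁-chain δ₂-chain δ₁≡Q δ₂≡Q δ₁≡ δ₂≡ a₁≢a₂ δ₁≡P
      with successor-prefix δ₁-chain δ₁≡ δ₁≡P
    ... | refl with ++-∷-cases Q (α ∷ʳ x) (≡.trans (≡.sym δ₁≡Q) δ₁≡P)
    ...   | inj₁ extends = extends
    ...   | inj₂ (Z , refl) =
      ⊥-elim (a₁≢a₂ (∷-injectiveˡ (proj₂ (chain-split-injective acyclic α α′ δ₂-chain δ₂≡′ δ₂≡))))
      where
      δ₂≡′ : δ₂ ≡ α ++ x ∷ a₁ ∷ Z ++ Y
      δ₂≡′ = begin
        δ₂                                ≡⟨ δ₂≡Q ⟩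
        ((α ∷ʳ x) ++ a₁ ∷ Z) ++ Y         ≡⟨ ++-assoc (α ∷ʳ x) (a₁ ∷ Z) Y ⟩
        (α ∷ʳ x) ++ a₁ ∷ Z ++ Y           ≡⟨ ∷ʳ-++ α x _ ⟩
        α ++ x ∷ a₁ ∷ Z ++ Y              ∎

    moves-keep-common-prefix : ∀ {v a a′ δ₁ δ₂ ns} Q {X Y} → Star* v δ₁ δ₂ ns →
      Chain a v δ₁ → Chain a′ v δ₂ → δ₁ ≡ Q ++ X → δ₂ ≡ Q ++ Y → ∀ {c} → c ∈ ns → ∃ λ Z → c ≡ Q ++ Z
    moves-keep-common-prefix Q (trivial _) _ _ δ₁≡Q _ (here refl) = _ , δ₁≡Q
    moves-keep-common-prefix Q
      (step {p' = p′} {pre₁} {pre₂} {b₁ = b₁} {b₂} {ns₁ = ns₁} _ _ _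
            (_ , _ , δ₁≡) (_ , _ , δ₂≡) a₁≢a₂ _ _ _ _ _ _ _ _ _ _ _
            p-chain refl _ _ δ₁≡pre₁ δ₂≡pre₂ b₁-chain _ b₂-chain _ refl refl moves₁ moves₂)
      δ₁-chain δ₂-chain δ₁≡Q δ₂≡Q c∈
      with successor-beyond-common-prefix Q δ₁-chain δ₂-chain δ₁≡Q δ₂≡Q δ₁≡ δ₂≡ a₁≢a₂ δ₁≡pre₁
         | successor-beyond-common-prefix Q δ₂-chain δ₁-chain δ₂≡Q δ₁≡Q δ₂≡ δ₁≡ (≡.≢-sym a₁≢a₂) δ₂≡pre₂
    ... | Z₁ , refl | Z₂ , refl with ∈-++⁻ ns₁ c∈
    ...   | inj₁ c∈₁ = moves-keep-common-prefix Q moves₁ δ₁-chain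
                         (moved-chain (Q ++ Z₁) (≡.subst (Chain _ _) δ₁≡pre₁ δ₁-chain) b₁-chain p-chain)
                         δ₁≡Q (++-assoc Q Z₁ _) c∈₁
    ...   | inj₂ c∈₂ = moves-keep-common-prefix Q moves₂
                         (moved-chain (Q ++ Z₂) (≡.subst (Chain _ _) δ₂≡pre₂ δ₂-chain) b₂-chain p-chain)
                         δ₂-chain (++-assoc Q Z₂ _) δ₂≡Q c∈₂

    module BranchingsOff {u v : Vertex} {γ : List Vertex} (γ-chain : Chain u v γ) where

      Branching : Set
      Branching = List Vertex × Vertex × Vertex

      _BranchesAt_ : List Vertex → Branching → Set
      δ BranchesAt b = BranchesOff γ δ b

      rank : Branching → ℕ
      rank (W , _ , _) = length W

      TwoFace : Subset m → Set
      TwoFace F = IsFace F × HasDim F 2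

      OpensOn : Subset m → Branching → Set
      OpensOn F (W , y , s) = ∃₂ λ g r → γ ≡ W ++ y ∷ g ∷ r × y ⟶ g × y ⟶ s × s ≢ g ×
                                         y Sub.∈ F × g Sub.∈ F × s Sub.∈ F

      TurnsOn : Subset m → Branching → Set
      TurnsOn F (W₂ , y₂ , s₂) = ∃₂ λ Q w → W₂ ≡ Q ∷ʳ w × w ⟶ y₂ × y₂ ⟶ s₂ ×
                                             w Sub.∈ F × y₂ Sub.∈ F × s₂ Sub.∈ F

      -- a move across the 2-face F with source y turns the branching b into b₂
      _⇜_ : Branching → Branching → Set
      b₂ ⇜ b = ∃ λ F → TwoFace F × OpensOn F b × TurnsOn F b₂ × rank b ℕ.< rank b₂

      turnsOn-face-unique : ∀ {F F′ b} → TwoFace F → TwoFace F′ → TurnsOn F b → TurnsOn F′ b → F ≡ F′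
      turnsOn-face-unique (F-face , F-dim) (F′-face , F′-dim)
                          (Q , w , W₂≡ , w⟶y₂ , y₂⟶s₂ , w∈F , y₂∈F , s₂∈F)
                          (Q′ , w′ , W₂≡′ , _ , _ , w′∈F′ , y₂∈F′ , s₂∈F′)
        with ∷ʳ-injective Q Q′ (≡.trans (≡.sym W₂≡) W₂≡′)
      ... | refl , refl =
        twoFace-unique F-face F-dim F′-face F′-dim w∈F y₂∈F s₂∈F w′∈F′ y₂∈F′ s₂∈F′
          (edge-face w⟶y₂) (edge-face y₂⟶s₂) (λ { refl → ⟶-asym w⟶y₂ y₂⟶s₂ })
          (≡.≢-sym (⟶⇒≢ y₂⟶s₂)) (⟶⇒≢ w⟶y₂)

      -- y is the source of F, its position on γ fixes W, and a third neighbour s′ of y is impossible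
      opensOn-unique : ∀ {F W y s W′ y′ s′} → TwoFace F → OpensOn F (W , y , s) → OpensOn F (W′ , y′ , s′) →
                       (W , y , s) ≡ (W′ , y′ , s′)
      opensOn-unique {W = W} {s = s} {W′} {s′ = s′} (F-face , F-dim)
                     (g , r , γ≡ , y⟶g , y⟶s , s≢g , y∈F , g∈F , s∈F)
                     (g′ , r′ , γ≡′ , y′⟶g′ , y′⟶s′ , s′≢g′ , y′∈F , g′∈F , s′∈F)
        with source-unique F-face (twoFace-source F-dim y∈F g∈F s∈F y⟶g y⟶s (≡.≢-sym s≢g))
                                  (twoFace-source F-dim y′∈F g′∈F s′∈F y′⟶g′ y′⟶s′ (≡.≢-sym s′≢g′))
      ... | refl with chain-split-injective acyclic W W′ γ-chain γ≡ γ≡′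
      ...   | refl , g∷r≡ with ∷-injective g∷r≡
      ...     | refl , _ with s F.≟ s′
      ...       | yes refl = refl
      ...       | no s≢s′ = ⊥-elim (twoFace-at-most-two-neighbours F-dim y∈F g∈F s∈F s′∈F
                              (edge-face y⟶g) (edge-face y⟶s) (edge-face y′⟶s′)
                              (≡.≢-sym (⟶⇒≢ y⟶g)) (≡.≢-sym (⟶⇒≢ y⟶s)) (≡.≢-sym (⟶⇒≢ y′⟶s′))
                              (≡.≢-sym s≢g) (≡.≢-sym s′≢g′) s≢s′)

      ⇜-deterministic : Deterministic _≡_ _⇜_
      ⇜-deterministic (F , F-two , opens , turns , _) (F′ , F′-two , opens′ , turns′ , _)
        with turnsOn-face-unique F-two F′-two turns turns′
      ... | refl = opensOn-unique F-two opens opens′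

      ⇜-rank : ∀ {b₂ b} → b₂ ⇜ b → rank b ℕ.< rank b₂
      ⇜-rank (_ , _ , _ , _ , rank<) = rank<

      agreement-tail : ∀ {t p′ P R} → Chain t v (t ∷ p′) → AgreeFrom t (t ∷ p′) γ → γ ≡ P ++ t ∷ R → p′ ≡ R
      agreement-tail {P = P} p-chain (α , β , ρ , p≡ , γ≡) γ≡′ =
        ≡.trans (proj₂ (chain-split-injective acyclic [] α p-chain refl p≡))
                (≡.sym (proj₂ (chain-split-injective acyclic P β γ-chain γ≡′ γ≡)))

      agreement-after-boundary : ∀ {g t B p′} P Z₀ {X} → Chain g t B → Chain t v (t ∷ p′) →
        (t ∈ γ → AgreeFrom t (t ∷ p′) γ) → γ ≡ (P ++ B ++ Z₀) ++ X → p′ ≡ Z₀ ++ X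
      agreement-after-boundary {t = t} {B} P Z₀ {X} B-chain p-chain agree γ≡ with chain-last B-chain
      ... | Bi , refl =
        agreement-tail p-chain (agree (≡.subst (t ∈_) (≡.sym γ≡t) (∈-++⁺ʳ (P ++ Bi) (here refl)))) γ≡t
        where
        γ≡t : γ ≡ (P ++ Bi) ++ t ∷ Z₀ ++ X
        γ≡t = begin
          γ                              ≡⟨ γ≡ ⟩
          (P ++ (Bi ∷ʳ t) ++ Z₀) ++ X    ≡⟨ cong (λ T → (P ++ T) ++ X) (∷ʳ-++ Bi t Z₀) ⟩
          (P ++ Bi ++ t ∷ Z₀) ++ X       ≡⟨ ++-assoc P (Bi ++ t ∷ Z₀) X ⟩
          P ++ (Bi ++ t ∷ Z₀) ++ X       ≡⟨ cong (P ++_) (++-assoc Bi (t ∷ Z₀) X) ⟩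
          P ++ Bi ++ t ∷ Z₀ ++ X         ≡⟨ ++-assoc P Bi _ ⟨
          (P ++ Bi) ++ t ∷ Z₀ ++ X       ∎

      -- if the boundary path ended before the branching, p would continue along γ
      moved-branching-on-boundary : ∀ {P g r t B′ p′ W₂ y₂ s₂} → γ ≡ P ++ g ∷ r →
        Chain g t (g ∷ B′) → Chain t v (t ∷ p′) → (t ∈ γ → AgreeFrom t (t ∷ p′) γ) →
        (P ++ (g ∷ B′) ++ p′) BranchesAt (W₂ , y₂ , s₂) →
        ∃₂ λ Z Z₁ → W₂ ∷ʳ y₂ ≡ P ++ g ∷ Z × g ∷ B′ ≡ (g ∷ Z) ++ s₂ ∷ Z₁
      moved-branching-on-boundary {P} {g} {r} {t} {B′} {p′} {W₂} {y₂} {s₂} γ≡ B-chain p-chain agree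
                                  branches@(g₂ , r₂ , q , γ≡₂ , δ≡₂ , s₂≢g₂) =
        conclude (++-∷-cases (g ∷ B′) (g ∷ Z) tail≡)
        where
        beyond-g = branchesOff-beyond-common-prefix (P ∷ʳ g) (≡.trans γ≡ (≡.sym (∷ʳ-++ P g r)))
                     (≡.sym (∷ʳ-++ P g (B′ ++ p′))) branches
        Z = proj₁ beyond-g
        W₂y₂≡ : W₂ ∷ʳ y₂ ≡ P ++ g ∷ Z
        W₂y₂≡ = ≡.trans (proj₂ beyond-g) (∷ʳ-++ P g Z)
        tail≡ : (g ∷ B′) ++ p′ ≡ (g ∷ Z) ++ s₂ ∷ q
        tail≡ = ++-cancelˡ P _ _ (begin
          P ++ g ∷ B′ ++ p′          ≡⟨ δ≡₂ ⟩
          W₂ ++ y₂ ∷ s₂ ∷ q          ≡⟨ ∷ʳ-++ W₂ y₂ _ ⟨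
          (W₂ ∷ʳ y₂) ++ s₂ ∷ q       ≡⟨ cong (_++ s₂ ∷ q) W₂y₂≡ ⟩
          (P ++ g ∷ Z) ++ s₂ ∷ q     ≡⟨ ++-assoc P (g ∷ Z) _ ⟩
          P ++ g ∷ Z ++ s₂ ∷ q       ∎)
        conclude : (∃ λ Z₀ → g ∷ Z ≡ (g ∷ B′) ++ Z₀) ⊎ (∃ λ Z₁ → g ∷ B′ ≡ (g ∷ Z) ++ s₂ ∷ Z₁) →
                   ∃₂ λ Z Z₁ → W₂ ∷ʳ y₂ ≡ P ++ g ∷ Z × g ∷ B′ ≡ (g ∷ Z) ++ s₂ ∷ Z₁
        conclude (inj₂ (Z₁ , B≡)) = Z , Z₁ , W₂y₂≡ , B≡
        conclude (inj₁ (Z₀ , g∷Z≡)) =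
          ⊥-elim (s₂≢g₂ (∷-injectiveˡ (++-cancelˡ Z₀ _ _ (≡.trans (≡.sym p′≡s₂) p′≡g₂))))
          where
          p′≡s₂ : p′ ≡ Z₀ ++ s₂ ∷ q
          p′≡s₂ = ++-cancelˡ (g ∷ B′) _ _
                    (≡.trans tail≡ (≡.trans (cong (_++ s₂ ∷ q) g∷Z≡) (++-assoc (g ∷ B′) Z₀ _)))
          p′≡g₂ : p′ ≡ Z₀ ++ g₂ ∷ r₂
          p′≡g₂ = agreement-after-boundary P Z₀ B-chain p-chain agree (begin
            γ                                ≡⟨ γ≡₂ ⟩
            W₂ ++ y₂ ∷ g₂ ∷ r₂               ≡⟨ ∷ʳ-++ W₂ y₂ _ ⟨
            (W₂ ∷ʳ y₂) ++ g₂ ∷ r₂            ≡⟨ cong (_++ g₂ ∷ r₂) W₂y₂≡ ⟩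
            (P ++ g ∷ Z) ++ g₂ ∷ r₂          ≡⟨ cong (λ T → (P ++ T) ++ g₂ ∷ r₂) g∷Z≡ ⟩
            (P ++ (g ∷ B′) ++ Z₀) ++ g₂ ∷ r₂ ∎)

      move-step : ∀ {W y g s r F t B′ p′ W₂ y₂ s₂} → γ ≡ W ++ y ∷ g ∷ r → y ⟶ s → s ≢ g →
        TwoFace F → y Sub.∈ F → g Sub.∈ F → s Sub.∈ F → Chain g t (g ∷ B′) → All (Sub._∈ F) (g ∷ B′) →
        Chain t v (t ∷ p′) → (t ∈ γ → AgreeFrom t (t ∷ p′) γ) →
        ((W ∷ʳ y) ++ (g ∷ B′) ++ p′) BranchesAt (W₂ , y₂ , s₂) → (W₂ , y₂ , s₂) ⇜ (W , y , s)
      move-step {W} {y} {g} {s} {r} {F} {t} {B′} {p′} {W₂} {y₂} {s₂} γ≡ y⟶s s≢g F-two y∈F g∈F s∈F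
                B-chain B⊆F p-chain agree branches@(g₂ , r₂ , q , γ≡₂ , δ≡₂ , _)
        with moved-branching-on-boundary (≡.trans γ≡ (≡.sym (∷ʳ-++ W y (g ∷ r)))) B-chain p-chain agree branches
      ... | Z , Z₁ , W₂y₂≡ , B≡
        with ∷ʳ≡-last-two W W₂ (≡.trans W₂y₂≡ (∷ʳ-++ W y (g ∷ Z)))
               (y∈F ∷ AllP.++⁻ˡ (g ∷ Z) (≡.subst (All (Sub._∈ F)) B≡ B⊆F))
      ... | Q , w , refl , w∈F , y₂∈F =
        F , F-two , opens , turns , prefix-length-< W (Q ∷ʳ w) (≡.trans W₂y₂≡ (∷ʳ-++ W y (g ∷ Z)))
        where
        γ′ = (W ∷ʳ y) ++ (g ∷ B′) ++ p′
        γ′-chain : Chain u v γ′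
        γ′-chain = moved-chain (W ∷ʳ y)
                     (≡.subst (Chain u v) (≡.trans γ≡ (≡.sym (∷ʳ-++ W y (g ∷ r)))) γ-chain) B-chain p-chain
        s₂∈F : s₂ Sub.∈ F
        s₂∈F = All.head (AllP.++⁻ʳ (g ∷ Z) (≡.subst (All (Sub._∈ F)) B≡ B⊆F))
        opens : OpensOn F (W , y , s)
        opens = g , r , γ≡ , chain-edge W (≡.subst (Chain u v) γ≡ γ-chain) , y⟶s , s≢g , y∈F , g∈F , s∈F
        turns : TurnsOn F (Q ∷ʳ w , y₂ , s₂)
        turns = Q , w , refl ,
                chain-edge Q (≡.subst (Chain u v) (≡.trans γ≡₂ (∷ʳ-++ Q w _)) γ-chain) ,
                chain-edge (Q ∷ʳ w) (≡.subst (Chain u v) δ≡₂ γ′-chain) ,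
                w∈F , y₂∈F , s₂∈F

      branching-history : ∀ {δ ns} → Chain u v δ → Star* v γ δ ns → ∀ {c} → c ∈ ns →
        c ≡ γ ⊎ ∃ λ b → c BranchesAt b × ∃ λ b₀ → δ BranchesAt b₀ × Star _⇜_ b b₀
      branching-history _ (trivial _) (here refl) = inj₁ refl
      branching-history {δ} δ-chain
        (step {x = x} {a₁} {a₂} {p' = p′} {ns₁ = ns₁} {ns₂} γ≢δ _ _ (α , β , γ≡) (α′ , β′ , δ≡) a₁≢a₂ minimal
              _ _ _ _ F-face F-dim x∈F a₁∈F a₂∈F _ p-chain refl _ agree γ≡pre₁ δ≡pre₂ b₁-chain b₁⊆F b₂-chain _
              refl refl moves₁ moves₂) {c} c∈
        with move-position γ-chain δ-chain γ≢δ γ≡ δ≡ minimal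
      ... | refl
        with successor-prefix γ-chain γ≡ γ≡pre₁ | successor-prefix δ-chain δ≡ δ≡pre₂
           | chain-head b₁-chain | chain-head b₂-chain
      ... | refl | refl | b₁′ , refl | b₂′ , refl = [ via-first-half , via-second-half ]′ (∈-++⁻ ns₁ c∈)
        where
        δ-branches : δ BranchesAt (α , x , a₂)
        δ-branches = a₁ , β , β′ , γ≡ , δ≡ , ≡.≢-sym a₁≢a₂

        History : Set
        History = c ≡ γ ⊎ ∃ λ b → c BranchesAt b × ∃ λ b₀ → δ BranchesAt b₀ × Star _⇜_ b b₀

        via-first-half : c ∈ ns₁ → History
        via-first-half c∈₁
          with branching-history (moved-chain (α ∷ʳ x) (≡.subst (Chain u v) γ≡pre₁ γ-chain) b₁-chain p-chain)
                                 moves₁ c∈₁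
        ... | inj₁ c≡γ = inj₁ c≡γ
        ... | inj₂ (b , c-branches , b₁ , moved-branches , b⇜*b₁) =
          inj₂ (b , c-branches , (α , x , a₂) , δ-branches ,
                b⇜*b₁ ◅◅ (move-step γ≡ (chain-edge α (≡.subst (Chain u v) δ≡ δ-chain)) (≡.≢-sym a₁≢a₂)
                            (F-face , F-dim) x∈F a₁∈F a₂∈F b₁-chain b₁⊆F p-chain agree moved-branches ◅ ε))

        -- the second half of the path only moves chains above x ⟶ a₂
        via-second-half : c ∈ ns₂ → History
        via-second-half c∈₂
          with moves-keep-common-prefix (α ++ x ∷ a₂ ∷ []) moves₂
                 (moved-chain (α ∷ʳ x) (≡.subst (Chain u v) δ≡pre₂ δ-chain) b₂-chain p-chain) δ-chain
                 (≡.trans (∷ʳ-++ α x _) (≡.sym (++-assoc α (x ∷ a₂ ∷ []) _)))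
                 (≡.trans δ≡ (≡.sym (++-assoc α (x ∷ a₂ ∷ []) β′))) c∈₂
        ... | Z , c≡ =
          inj₂ ((α , x , a₂) , (a₁ , β , Z , γ≡ , ≡.trans c≡ (++-assoc α (x ∷ a₂ ∷ []) Z) , ≡.≢-sym a₁≢a₂) ,
                (α , x , a₂) , δ-branches , ε)

open import Data.List using (List; []; _∷_)
open import Data.List.Membership.Propositional using (_∈_)

lemma4p6 : (K : OrderedField) (n m : ℕ) (V : Fin m → Fin n → OrderedField.Carrier K)
    (_⟶_ : Fin m → Fin m → Set) →
    let open Polytope K V _⟶_ in
    IsVertexList → IsFacialOrientation → DirectionallySimple → IsHasseOfLattice →
    ∀ (u v : Fin m) (γ γ₁ γ₁' : List (Fin m)) →
    Chain u v γ → Chain u v γ₁ → Chain u v γ₁' →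
    ∀ (a a₁ a₁' : Fin m) (r r₁ r₁' : List (Fin m)) →
    γ ≡ u ∷ a ∷ r → γ₁ ≡ u ∷ a₁ ∷ r₁ → γ₁' ≡ u ∷ a₁' ∷ r₁' →
    a ≢ a₁ → a ≢ a₁' → a₁ ≢ a₁' →
    ∀ (ns ns' : List (List (Fin m))) →
    Star* v γ γ₁ ns → Star* v γ γ₁' ns' →
    (γ ∈ ns × γ ∈ ns') × (∀ c → c ∈ ns → c ∈ ns' → c ≡ γ)
lemma4p6 K n m V _⟶_ _ (orientation , acyclic , facial) _ _ u v γ γ₁ γ₁′ γ-chain γ₁-chain γ₁′-chain
         a a₁ a₁′ r r₁ r₁′ refl refl refl a≢a₁ a≢a₁′ a₁≢a₁′ ns ns′ moves moves′ =
  (first-node moves , first-node moves′) , only-γ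
  where
  open Moves K V _⟶_
  open BranchingsOff orientation acyclic facial γ-chain
  open DeterministicStar _⇜_ rank ⇜-rank ⇜-deterministic
  open ListProperties using (branchesOff-unique)

  only-γ : ∀ c → c ∈ ns → c ∈ ns′ → c ≡ γ
  only-γ c c∈ c∈′ with branching-history γ₁-chain moves c∈ | branching-history γ₁′-chain moves′ c∈′
  ... | inj₁ c≡γ | _        = c≡γ
  ... | inj₂ _   | inj₁ c≡γ = c≡γ
  ... | inj₂ ((W , _) , c-at , (W₀ , _) , γ₁-at , b⇜*b₀)
      | inj₂ ((W′ , _) , c-at′ , (W₀′ , _) , γ₁′-at , b′⇜*b₀′)
    with branchesOff-unique W W′ c-at c-at′
       | branchesOff-unique W₀ [] γ₁-at (a , r , r₁ , refl , refl , ≡.≢-sym a≢a₁)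
       | branchesOff-unique W₀′ [] γ₁′-at (a , r , r₁′ , refl , refl , ≡.≢-sym a≢a₁′)
  ... | refl | refl | refl =
    ⊥-elim (a₁≢a₁′ (cong (λ b → proj₂ (proj₂ b)) (star-rank-injective b⇜*b₀ b′⇜*b₀′ refl)))
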